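{- For every integer $k\ge 2$, let $T(k,2)$ be the complete $k$-ary tree of height $2$ (a root $x$ with children $x_1,\dots,x_k$, each $x_i$ having exactly $k$ children $x_{i1},\dots,x_{ik}$, which are leaves). Then $\tau(T(k,2))=k$ and $\beta_p(T(k,2))=k+1$.
   Context: Two vertices $u,v$ are twins if $N(u)\setminus\{v\}=N(v)\setminus\{u\}$; twin classes are the equivalence classes of this relation and $\tau(G)$ is the maximum cardinality of a twin class. For $u$ a vertex and $S$ a vertex set, $d(u,S)=\min_{w\in S}d(u,w)$. A partition $\Pi=\{S_1,\dots,S_k\}$ of $V(G)$ is locating if the vectors $r(u|\Pi)=(d(u,S_1),\dots,d(u,S_k))$ are pairwise distinct over $u\in V(G)$; $\beta_p(G)$ is the minimum size of a locating partition. -}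

module Defs where

open import Data.Nat using (ℕ; zero; suc; _+_; _*_; _≤_; _⊓_)
open import Data.Fin using (Fin; splitAt; remQuot)
open import Data.Fin.Properties using (_≟_)
open import Data.Bool using (Bool; true; false; _∧_; _∨_; not; if_then_else_)
open import Data.List using (List; filter; length; map; foldr)
open import Data.Bool.ListAction using (any; all)
open import Data.List using () renaming (allFin to allFinL)
open import Data.Sum using (_⊎_; inj₁; inj₂)
open import Data.Product using (Σ; ∃; _×_; _,_)
open import Relation.Binary.PropositionalEquality using (_≡_; refl; sym)
open import Relation.Nullary using (yes; no)
open import Data.Empty using (⊥-elim)
open import Relation.Nullary.Decidable using (⌊_⌋)

record Graph (n : ℕ) : Set where
  field
    adj     : Fin n → Fin n → Bool
    adj-sym : ∀ u v → adj u v ≡ adj v u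
    adj-irr : ∀ u → adj u u ≡ false
open Graph public

allFin : (n : ℕ) → List (Fin n)
allFin n = allFinL n

_=ᵇ_ : {n : ℕ} → Fin n → Fin n → Bool
u =ᵇ v = ⌊ u ≟ v ⌋

_==_ : Bool → Bool → Bool
true  == b = b
false == b = not b

reach : {n : ℕ} → Graph n → ℕ → Fin n → Fin n → Bool
reach G zero    u v = u =ᵇ v
reach {n} G (suc m) u v =
  reach G m u v ∨ any (λ w → adj G u w ∧ reach G m w v) (allFin n)

searchDist : {n : ℕ} → Graph n → Fin n → Fin n → ℕ → ℕ → ℕ
searchDist G u v start zero       = start
searchDist G u v start (suc fuel) =
  if reach G start u v then start else searchDist G u v (suc start) fuel

-- graph distance d(u,v); for vertices in different components
-- (never the case in a connected graph) it returns n as a stand-in for ∞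
dist : {n : ℕ} → Graph n → Fin n → Fin n → ℕ
dist {n} G u v = searchDist G u v 0 n

-- d(u,S) = min_{w ∈ S} d(u,w), for S given as a Boolean predicate
-- (the value n is only returned for empty S / unreachable S)
setDist : {n : ℕ} → Graph n → Fin n → (Fin n → Bool) → ℕ
setDist {n} G u S =
  foldr (λ w acc → if S w then dist G u w ⊓ acc else acc) n (allFin n)

-- A partition Π = {S_1,…,S_k} of V(G) into k (nonempty) classes is given by
-- a surjective class map c : V → Fin k, S_i = c⁻¹(i).
IsPartition : {n : ℕ} (k : ℕ) → (Fin n → Fin k) → Set
IsPartition {n} k c = ∀ (i : Fin k) → ∃ λ (u : Fin n) → c u ≡ i

rvec : {n k : ℕ} → Graph n → (Fin n → Fin k) → Fin n → Fin k → ℕ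
rvec G c u i = setDist G u (λ w → c w =ᵇ i)

IsLocating : {n k : ℕ} → Graph n → (Fin n → Fin k) → Set
IsLocating {n} {k} G c =
  ∀ (u v : Fin n) → (∀ (i : Fin k) → rvec G c u i ≡ rvec G c v i) → u ≡ v

HasLocatingPartition : {n : ℕ} → Graph n → ℕ → Set
HasLocatingPartition {n} G k =
  Σ (Fin n → Fin k) λ c → IsPartition k c × IsLocating G c

PartitionDimension : {n : ℕ} → Graph n → ℕ → Set
PartitionDimension G m =
  HasLocatingPartition G m × (∀ j → HasLocatingPartition G j → m ≤ j)

-- u,v twins iff N(u)∖{v} = N(v)∖{u}, i.e. for every w ∉ {u,v}:
-- w ~ u ⟺ w ~ v
twinᵇ : {n : ℕ} → Graph n → Fin n → Fin n → Bool
twinᵇ {n} G u v =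
  all (λ w → (w =ᵇ u) ∨ (w =ᵇ v) ∨ (adj G u w == adj G v w)) (allFin n)

twinClassSize : {n : ℕ} → Graph n → Fin n → ℕ
twinClassSize {n} G u = length (filter (λ v → twinᵇ G u v ≟ᵇ true) (allFin n))
  where
  open import Data.Bool.Properties renaming (_≟_ to _≟ᵇ_)

TwinNumber : {n : ℕ} → Graph n → ℕ → Set
TwinNumber {n} G m =
  (∃ λ (u : Fin n) → twinClassSize G u ≡ m) × (∀ (u : Fin n) → twinClassSize G u ≤ m)

=ᵇ-sym : {n : ℕ} (i j : Fin n) → (i =ᵇ j) ≡ (j =ᵇ i)
=ᵇ-sym i j with i ≟ j | j ≟ i
... | yes _ | yes _ = refl
... | no _  | no _  = refl
... | yes p | no q  = ⊥-elim (q (sym p))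
... | no p  | yes q = ⊥-elim (p (sym q))

data TVtx (k : ℕ) : Set where
  root : TVtx k
  mid  : Fin k → TVtx k
  leaf : Fin k → Fin k → TVtx k

tadj : {k : ℕ} → TVtx k → TVtx k → Bool
tadj root       (mid _)    = true
tadj (mid _)    root       = true
tadj (mid i)    (leaf i′ _) = i =ᵇ i′
tadj (leaf i _) (mid i′)   = i =ᵇ i′
tadj _          _          = false

-- vertex set Fin (1 + (k + k * k)); decoding via the standard library
-- bijections Fin (m + n) ↔ Fin m ⊎ Fin n (splitAt) and
-- Fin (m * n) ↔ Fin m × Fin n (remQuot)
tsize : ℕ → ℕ
tsize k = 1 + (k + k * k)

decode : (k : ℕ) → Fin (tsize k) → TVtx k
decode k x with splitAt 1 x
... | inj₁ _ = root
... | inj₂ y with splitAt k y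
...   | inj₁ i = mid i
...   | inj₂ z with remQuot {k} k z
...     | (i , j) = leaf i j

tadj-sym : {k : ℕ} (a b : TVtx k) → tadj a b ≡ tadj b a
tadj-sym root root = refl
tadj-sym root (mid _) = refl
tadj-sym root (leaf _ _) = refl
tadj-sym (mid _) root = refl
tadj-sym (mid i) (mid j) = refl
tadj-sym (mid i) (leaf j _) = =ᵇ-sym i j
tadj-sym (leaf _ _) root = refl
tadj-sym (leaf i _) (mid j) = =ᵇ-sym i j
tadj-sym (leaf _ _) (leaf _ _) = refl

tadj-irr : {k : ℕ} (a : TVtx k) → tadj a a ≡ false
tadj-irr root = refl
tadj-irr (mid _) = refl
tadj-irr (leaf _ _) = refl

T : (k : ℕ) → Graph (tsize k)
T k = record
  { adj     = λ u v → tadj (decode k u) (decode k v)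
  ; adj-sym = λ u v → tadj-sym (decode k u) (decode k v)
  ; adj-irr = λ u → tadj-irr (decode k u)
  }

-- On T(k,2) the twin classes are {x_{i1},…,x_{ik}} and singletons, giving τ.
-- For β_p, the partition {x}, {x_i, x_{1i},…,x_{ki}} (i = 1…k) is locating.
-- Conversely, the k sibling leaves of one x_i are twins, hence lie in k
-- distinct classes; with exactly k classes every x_i and x would then be
-- adjacent to every class, forcing two of them to share a representation.

module Submission where

open import Defs
open import Data.Nat using (ℕ; zero; suc; _+_; _*_; _≤_; _<_; _⊓_; z≤n; s≤s)
open import Data.Nat.Properties
  using (≤-refl; ≤-trans; ≤-reflexive; n≤1+n; n≤0⇒n≡0; <-irrefl; ≤-<-trans; m⊓n≤m; m⊓n≤n; ⊓-sel;
         1+n≰n; ≰⇒>; m≤n⇒m<n∨m≡n; *-identityˡ)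
open import Data.Fin using (Fin; zero; suc; splitAt; remQuot; combine; _↑ˡ_; _↑ʳ_; punchOut)
open import Data.Fin.Properties
  using (_≟_; suc-injective; splitAt-↑ˡ; splitAt-↑ʳ; remQuot-combine; combine-remQuot;
         splitAt⁻¹-↑ˡ; splitAt⁻¹-↑ʳ; 0≢1+n; any?; punchOut-injective; injective⇒≤; <⇒notInjective)
open import Data.Bool using (Bool; true; false; _∧_; _∨_; if_then_else_)
open import Data.Bool.Properties using (T-≡) renaming (_≟_ to _≟ᵇ_)
open import Data.Bool.ListAction using (any; all; or)
open import Data.List using ([]; _∷_; foldr; filter; length; tabulate)
open import Data.List.Properties using (map-cong)
open import Data.List.Membership.Propositional using (_∈_; find; lose)
open import Data.List.Relation.Unary.Any using (here; there)
open import Data.List.Membership.Propositional.Properties using (∈-allFin)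
open import Data.List.Relation.Unary.Any.Properties using (any⁺; any⁻)
open import Data.List.Relation.Unary.All using () renaming (lookup to All-lookup; tabulate to All-tabulate)
open import Data.List.Relation.Unary.All.Properties using (all⁺; all⁻)
open import Data.Product using (∃; _×_; _,_; uncurry)
open import Data.Sum using (_⊎_; inj₁; inj₂)
open import Data.Empty using (⊥; ⊥-elim)
open import Function using (_∘_)
open import Function.Bundles using (Equivalence)
open import Function.Definitions using (Injective)
open import Relation.Binary.PropositionalEquality
open import Relation.Nullary using (yes; no)

open Equivalence using (to; from)

=ᵇ⇒≡ : ∀ {n} {i j : Fin n} → (i =ᵇ j) ≡ true → i ≡ j
=ᵇ⇒≡ {i = i} {j} eq with i ≟ j
... | yes i≡j = i≡j

=ᵇ-refl : ∀ {n} (i : Fin n) → (i =ᵇ i) ≡ true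
=ᵇ-refl i with i ≟ i
... | yes _ = refl
... | no i≢i = ⊥-elim (i≢i refl)

=ᵇ-≢ : ∀ {n} {i j : Fin n} → i ≢ j → (i =ᵇ j) ≡ false
=ᵇ-≢ {i = i} {j} i≢j with i ≟ j
... | yes i≡j = ⊥-elim (i≢j i≡j)
... | no _ = refl

==⇒≡ : ∀ {a b} → (a == b) ≡ true → a ≡ b
==⇒≡ {true} {true} _ = refl
==⇒≡ {false} {false} _ = refl

≡⇒== : ∀ {a b} → a ≡ b → (a == b) ≡ true
≡⇒== {true} refl = refl
≡⇒== {false} refl = refl

∨-third : ∀ {a b c} → c ≡ true → (a ∨ b ∨ c) ≡ true
∨-third {true} _ = refl
∨-third {false} {true} _ = refl
∨-third {false} {false} c≡true = c≡true

∧-true : ∀ {a b} → (a ∧ b) ≡ true → a ≡ true × b ≡ true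
∧-true {true} {true} _ = refl , refl

∨-right : ∀ {a b} → a ≡ false → (a ∨ b) ≡ true → b ≡ true
∨-right refl h = h

∨-resolve : ∀ {a b c} → a ≡ false → b ≡ false → (a ∨ b ∨ c) ≡ true → c ≡ true
∨-resolve refl refl h = h

≢true⇒≡false : ∀ {b} → b ≢ true → b ≡ false
≢true⇒≡false {true} b≢true = ⊥-elim (b≢true refl)
≢true⇒≡false {false} _ = refl

-- The list tests `any` and `all`, read through membership
-- (the library versions are phrased with T instead of ≡ true).
module _ {A : Set} (p : A → Bool) where

  any-witness : ∀ xs → any p xs ≡ true → ∃ λ x → p x ≡ true
  any-witness xs holds with x , _ , px ← find (any⁻ p xs (from T-≡ holds)) = x , to T-≡ px

  any-member : ∀ {x xs} → x ∈ xs → p x ≡ true → any p xs ≡ true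
  any-member x∈xs px = to T-≡ (any⁺ p (lose x∈xs (from T-≡ px)))

  all-member : ∀ {x xs} → x ∈ xs → all p xs ≡ true → p x ≡ true
  all-member {xs = xs} x∈xs holds = to T-≡ (All-lookup (all⁺ p xs (from T-≡ holds)) x∈xs)

  all-everywhere : ∀ xs → (∀ x → p x ≡ true) → all p xs ≡ true
  all-everywhere xs everywhere = to T-≡ (all⁻ p {xs = xs} (All-tabulate (λ {x} _ → from T-≡ (everywhere x))))

any-cong : ∀ {A : Set} {p q : A → Bool} → (∀ x → p x ≡ q x) → ∀ xs → any p xs ≡ any q xs
any-cong p≗q xs = cong or (map-cong p≗q xs)

count : (n : ℕ) → (Fin n → Bool) → ℕ
count zero p = 0
count (suc n) p = if p zero then suc (count n (p ∘ suc)) else count n (p ∘ suc)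

length-filter : ∀ {A : Set} n (f : Fin n → A) (p : A → Bool) →
                length (filter (λ x → p x ≟ᵇ true) (tabulate f)) ≡ count n (p ∘ f)
length-filter zero f p = refl
length-filter (suc n) f p with p (f zero)
... | true = cong suc (length-filter n (f ∘ suc) p)
... | false = length-filter n (f ∘ suc) p

count-cong : ∀ n {p q : Fin n → Bool} → (∀ x → p x ≡ q x) → count n p ≡ count n q
count-cong zero p≗q = refl
count-cong (suc n) p≗q
  rewrite p≗q zero | count-cong n (p≗q ∘ suc) = refl

count-const : ∀ n b → count n (λ _ → b) ≡ (if b then n else 0)
count-const zero true = refl
count-const zero false = refl
count-const (suc n) true = cong suc (count-const n true)
count-const (suc n) false = count-const n false

count-unique : ∀ n (p : Fin n → Bool) u → p u ≡ true → (∀ x → p x ≡ true → x ≡ u) → count n p ≡ 1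
count-unique (suc n) p zero pu only-u rewrite pu =
  cong suc (trans (count-cong n (λ x → ≢true⇒≡false (λ px → 0≢1+n (sym (only-u (suc x) px)))))
                  (count-const n false))
count-unique (suc n) p (suc u) pu only-u
  rewrite ≢true⇒≡false {p zero} (λ p0 → 0≢1+n (only-u zero p0)) =
  count-unique n (p ∘ suc) u pu (λ x px → suc-injective (only-u (suc x) px))

count-+ : ∀ m n (p : Fin (m + n) → Bool) →
          count (m + n) p ≡ count m (λ x → p (x ↑ˡ n)) + count n (λ y → p (m ↑ʳ y))
count-+ zero n p = refl
count-+ (suc m) n p with p zero
... | true = cong suc (count-+ m n (p ∘ suc))
... | false = count-+ m n (p ∘ suc)

count-rows : ∀ m n (p : Fin (m * n) → Bool) (q : Fin m → Bool) →
             (∀ i j → p (combine i j) ≡ q i) → count (m * n) p ≡ count m q * n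
count-rows zero n p q rows = refl
count-rows (suc m) n p q rows = begin
    count (n + m * n) p
  ≡⟨ count-+ n (m * n) p ⟩
    count n (λ j → p (j ↑ˡ (m * n))) + count (m * n) (λ z → p (n ↑ʳ z))
  ≡⟨ cong₂ _+_ (trans (count-cong n (rows zero)) (count-const n (q zero)))
               (count-rows m n (λ z → p (n ↑ʳ z)) (q ∘ suc) (rows ∘ suc)) ⟩
    (if q zero then n else 0) + count m (q ∘ suc) * n
  ≡⟨ first-row (q zero) ⟩
    count (suc m) q * n ∎
  where
  open ≡-Reasoning
  first-row : ∀ b → (if b then n else 0) + count m (q ∘ suc) * n
                  ≡ (if b then suc (count m (q ∘ suc)) else count m (q ∘ suc)) * n
  first-row true = refl
  first-row false = refl

module Distances {m : ℕ} (G : Graph (suc (suc m))) where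

  N : ℕ
  N = suc (suc m)

  searchDist-≥ : ∀ u w s fuel → s ≤ searchDist G u w s fuel
  searchDist-≥ u w s zero = ≤-refl
  searchDist-≥ u w s (suc fuel) with reach G s u w
  ... | true = ≤-refl
  ... | false = ≤-trans (n≤1+n s) (searchDist-≥ u w (suc s) fuel)

  searchDist-hit : ∀ u w s fuel → reach G s u w ≡ true → searchDist G u w s (suc fuel) ≡ s
  searchDist-hit u w s fuel hit rewrite hit = refl

  searchDist-miss : ∀ u w s fuel → reach G s u w ≡ false →
                    searchDist G u w s (suc fuel) ≡ searchDist G u w (suc s) fuel
  searchDist-miss u w s fuel miss rewrite miss = refl

  reach₁-adj : ∀ u w → adj G u w ≡ true → reach G 1 u w ≡ true
  reach₁-adj u w uw with u =ᵇ w
  ... | true = refl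
  ... | false = any-member (λ x → adj G u x ∧ (x =ᵇ w)) (∈-allFin w)
                  (subst (λ b → b ∧ (w =ᵇ w) ≡ true) (sym uw) (=ᵇ-refl w))

  reach₁⇒adj : ∀ u w → reach G 0 u w ≡ false → reach G 1 u w ≡ true → adj G u w ≡ true
  reach₁⇒adj u w u≢w walk
    with x , hit ← any-witness (λ x → adj G u x ∧ (x =ᵇ w)) (allFin N) (∨-right u≢w walk)
    with ux , x≡w ← ∧-true {adj G u x} hit
    with refl ← =ᵇ⇒≡ {i = x} x≡w = ux

  dist-refl : ∀ u → dist G u u ≡ 0
  dist-refl u rewrite =ᵇ-refl u = refl

  dist≥1 : ∀ u w → reach G 0 u w ≡ false → 1 ≤ dist G u w
  dist≥1 u w u≢w = subst (1 ≤_) (sym (searchDist-miss u w 0 (suc m) u≢w)) (searchDist-≥ u w 1 (suc m))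

  dist≡0⇒≡ : ∀ u w → dist G u w ≡ 0 → u ≡ w
  dist≡0⇒≡ u w d≡0 = by-cases (u =ᵇ w) refl
    where
    by-cases : ∀ b → (u =ᵇ w) ≡ b → u ≡ w
    by-cases true u=w = =ᵇ⇒≡ u=w
    by-cases false u≢w with () ← ≤-trans (dist≥1 u w u≢w) (≤-reflexive d≡0)

  adj⇒dist≤1 : ∀ u w → adj G u w ≡ true → dist G u w ≤ 1
  adj⇒dist≤1 u w uw = by-cases (u =ᵇ w) refl
    where
    by-cases : ∀ b → (u =ᵇ w) ≡ b → dist G u w ≤ 1
    by-cases true u=w = ≤-trans (≤-reflexive (searchDist-hit u w 0 (suc m) u=w)) z≤n
    by-cases false u≢w = ≤-reflexive (trans (searchDist-miss u w 0 (suc m) u≢w)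
                                            (searchDist-hit u w 1 m (reach₁-adj u w uw)))

  dist≤1⇒adj : ∀ u w → dist G u w ≤ 1 → u ≡ w ⊎ adj G u w ≡ true
  dist≤1⇒adj u w d≤1 = by-cases (u =ᵇ w) refl (reach G 1 u w) refl
    where
    by-cases : ∀ b → (u =ᵇ w) ≡ b → ∀ b₁ → reach G 1 u w ≡ b₁ → u ≡ w ⊎ adj G u w ≡ true
    by-cases true u=w _ _ = inj₁ (=ᵇ⇒≡ u=w)
    by-cases false u≢w true walk = inj₂ (reach₁⇒adj u w u≢w walk)
    by-cases false u≢w false no-walk = ⊥-elim (1+n≰n (≤-trans (searchDist-≥ u w 2 m)
      (≤-trans (≤-reflexive (sym (trans (searchDist-miss u w 0 (suc m) u≢w)
                                        (searchDist-miss u w 1 m no-walk)))) d≤1)))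

  dist-cong : ∀ u v w → (∀ r → reach G r u w ≡ reach G r v w) → dist G u w ≡ dist G v w
  dist-cong u v w same-reach = search 0 N
    where
    search : ∀ s fuel → searchDist G u w s fuel ≡ searchDist G v w s fuel
    search s zero = refl
    search s (suc fuel) rewrite same-reach s with reach G s v w
    ... | true = refl
    ... | false = search (suc s) fuel

  private
    step : Fin N → (Fin N → Bool) → Fin N → ℕ → ℕ
    step u S w acc = if S w then dist G u w ⊓ acc else acc

  setDist≤ : ∀ u S w → S w ≡ true → setDist G u S ≤ dist G u w
  setDist≤ u S w Sw = go (allFin N) (∈-allFin w)
    where
    go : ∀ xs → w ∈ xs → foldr (step u S) N xs ≤ dist G u w
    go (x ∷ xs) (here refl) rewrite Sw = m⊓n≤m _ _
    go (x ∷ xs) (there w∈xs) with S x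
    ... | true = ≤-trans (m⊓n≤n _ _) (go xs w∈xs)
    ... | false = go xs w∈xs

  setDist-attained : ∀ u S → setDist G u S < N → ∃ λ w → S w ≡ true × setDist G u S ≡ dist G u w
  setDist-attained u S = go (allFin N)
    where
    go : ∀ xs → foldr (step u S) N xs < N → ∃ λ w → S w ≡ true × foldr (step u S) N xs ≡ dist G u w
    go [] N<N = ⊥-elim (<-irrefl refl N<N)
    go (x ∷ xs) below with S x in Sx
    ... | false = go xs below
    ... | true with ⊓-sel (dist G u x) (foldr (step u S) N xs)
    ...   | inj₁ at-x = x , Sx , at-x
    ...   | inj₂ at-rest with w , Sw , eq ← go xs (subst (_< N) at-rest below) =
            w , Sw , trans at-rest eq

  setDist-cong : ∀ u v S → (∀ w → S w ≡ true → dist G u w ≡ dist G v w) → setDist G u S ≡ setDist G v S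
  setDist-cong u v S same = go (allFin N)
    where
    go : ∀ xs → foldr (step u S) N xs ≡ foldr (step v S) N xs
    go [] = refl
    go (x ∷ xs) with S x in Sx
    ... | true = cong₂ _⊓_ (same x Sx) (go xs)
    ... | false = go xs

  twins-reach : ∀ u v → (∀ x → adj G u x ≡ adj G v x) →
                ∀ w → u ≢ w → v ≢ w → ∀ r → reach G r u w ≡ reach G r v w
  twins-reach u v same-row w u≢w v≢w zero = trans (=ᵇ-≢ u≢w) (sym (=ᵇ-≢ v≢w))
  twins-reach u v same-row w u≢w v≢w (suc r) =
    cong₂ _∨_ (twins-reach u v same-row w u≢w v≢w r)
              (any-cong (λ x → cong (_∧ reach G r x w) (same-row x)) (allFin N))

module Representations {m : ℕ} (G : Graph (suc (suc m))) {j : ℕ} (c : Fin (suc (suc m)) → Fin j) where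

  open Distances G

  SameCode : Fin N → Fin N → Set
  SameCode u v = ∀ l → rvec G c u l ≡ rvec G c v l

  SeesAllClasses : Fin N → Set
  SeesAllClasses u = ∀ l → ∃ λ w → c w ≡ l × adj G u w ≡ true

  rvec-own : ∀ u → rvec G c u (c u) ≡ 0
  rvec-own u = n≤0⇒n≡0 (≤-trans (setDist≤ u (λ w → c w =ᵇ c u) u (=ᵇ-refl (c u)))
                                (≤-reflexive (dist-refl u)))

  rvec≡0⇒ : ∀ u l → rvec G c u l ≡ 0 → c u ≡ l
  rvec≡0⇒ u l r≡0
    with w , w∈l , at-w ← setDist-attained u (λ w → c w =ᵇ l) (subst (_< N) (sym r≡0) (s≤s z≤n))
    with refl ← dist≡0⇒≡ u w (trans (sym at-w) r≡0) = =ᵇ⇒≡ w∈l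

  rvec≤1 : ∀ u w → adj G u w ≡ true → rvec G c u (c w) ≤ 1
  rvec≤1 u w uw = ≤-trans (setDist≤ u (λ x → c x =ᵇ c w) w (=ᵇ-refl (c w))) (adj⇒dist≤1 u w uw)

  rvec≤1⇒ : ∀ u l → rvec G c u l ≤ 1 → ∃ λ w → c w ≡ l × (u ≡ w ⊎ adj G u w ≡ true)
  rvec≤1⇒ u l r≤1
    with w , w∈l , at-w ← setDist-attained u (λ w → c w =ᵇ l) (≤-<-trans r≤1 (s≤s (s≤s z≤n))) =
    w , =ᵇ⇒≡ w∈l , dist≤1⇒adj u w (subst (_≤ 1) at-w r≤1)

  sameClass-own : ∀ u v → c u ≡ c v → ∀ l → c u ≡ l → rvec G c u l ≡ rvec G c v l
  sameClass-own u v cu≡cv l refl =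
    trans (rvec-own u) (sym (subst (λ k → rvec G c v k ≡ 0) (sym cu≡cv) (rvec-own v)))

  sameCode⇒sameClass : ∀ u v → SameCode u v → c u ≡ c v
  sameCode⇒sameClass u v same = sym (rvec≡0⇒ v (c u) (trans (sym (same (c u))) (rvec-own u)))

  sameCode-near : ∀ u v → SameCode u v → ∀ w → adj G u w ≡ true →
                  ∃ λ w′ → c w′ ≡ c w × (v ≡ w′ ⊎ adj G v w′ ≡ true)
  sameCode-near u v same w uw = rvec≤1⇒ v (c w) (subst (_≤ 1) (same (c w)) (rvec≤1 u w uw))

  twins-sameCode : ∀ u v → (∀ x → adj G u x ≡ adj G v x) → c u ≡ c v → SameCode u v
  twins-sameCode u v same-row cu≡cv l with c u ≟ l
  ... | yes cu≡l = sameClass-own u v cu≡cv l cu≡l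
  ... | no cu≢l = setDist-cong u v (λ w → c w =ᵇ l) λ w w∈l →
    dist-cong u v w (twins-reach u v same-row w
      (λ u≡w → cu≢l (trans (cong c u≡w) (=ᵇ⇒≡ w∈l)))
      (λ v≡w → cu≢l (trans cu≡cv (trans (cong c v≡w) (=ᵇ⇒≡ w∈l)))))

  seesAll-rvec : ∀ u → SeesAllClasses u → ∀ l → c u ≢ l → rvec G c u l ≡ 1
  seesAll-rvec u sees l cu≢l with w , w∈l , uw ← sees l = exactly-one (rvec G c u l) refl
    where
    exactly-one : ∀ r → rvec G c u l ≡ r → r ≡ 1
    exactly-one zero r≡0 = ⊥-elim (cu≢l (rvec≡0⇒ u l r≡0))
    exactly-one (suc zero) _ = refl
    exactly-one (suc (suc r)) r≡2+ =
      ⊥-elim (1+n≰n (≤-trans (s≤s (s≤s z≤n)) (subst (_≤ 1) (trans (cong (rvec G c u) w∈l) r≡2+)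
                                                  (rvec≤1 u w uw))))

  seesAll-sameCode : ∀ u v → SeesAllClasses u → SeesAllClasses v → c u ≡ c v → SameCode u v
  seesAll-sameCode u v sees-u sees-v cu≡cv l with c u ≟ l
  ... | yes cu≡l = sameClass-own u v cu≡cv l cu≡l
  ... | no cu≢l = trans (seesAll-rvec u sees-u l cu≢l)
                        (sym (seesAll-rvec v sees-v l (λ cv≡l → cu≢l (trans cu≡cv cv≡l))))

module Twins {n : ℕ} (G : Graph n) where

  private
    test : Fin n → Fin n → Fin n → Bool
    test u v w = (w =ᵇ u) ∨ (w =ᵇ v) ∨ (adj G u w == adj G v w)

  twin-intro : ∀ u v → (∀ w → adj G u w ≡ adj G v w) → twinᵇ G u v ≡ true
  twin-intro u v same-row =
    all-everywhere (test u v) (allFin n) (λ w → ∨-third {w =ᵇ u} {w =ᵇ v} (≡⇒== (same-row w)))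

  twin-elim : ∀ u v → twinᵇ G u v ≡ true → ∀ w → w ≢ u → w ≢ v → adj G u w ≡ adj G v w
  twin-elim u v twins w w≢u w≢v =
    ==⇒≡ (∨-resolve (=ᵇ-≢ w≢u) (=ᵇ-≢ w≢v) (all-member (test u v) (∈-allFin w) twins))

  not-twin : ∀ u v w → w ≢ u → w ≢ v → adj G u w ≢ adj G v w → twinᵇ G u v ≡ false
  not-twin u v w w≢u w≢v differ = ≢true⇒≡false (λ twins → differ (twin-elim u v twins w w≢u w≢v))

  twinClassSize-count : ∀ u → twinClassSize G u ≡ count n (twinᵇ G u)
  twinClassSize-count u = length-filter n (λ x → x) (twinᵇ G u)

injective⇒surjective : ∀ {n} (f : Fin n → Fin n) → Injective _≡_ _≡_ f → ∀ y → ∃ λ x → f x ≡ y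
injective⇒surjective {suc n} f f-inj y with any? (λ x → f x ≟ y)
... | yes hit = hit
... | no miss = ⊥-elim (1+n≰n (injective⇒≤ {f = avoid-y} avoid-y-injective))
  where
  y≢f : ∀ x → y ≢ f x
  y≢f x y≡fx = miss (x , sym y≡fx)
  -- f, viewed as a map into Fin (suc n) ∖ {y} ≅ Fin n
  avoid-y : Fin (suc n) → Fin n
  avoid-y x = punchOut (y≢f x)
  avoid-y-injective : Injective _≡_ _≡_ avoid-y
  avoid-y-injective {x} {x′} eq = f-inj (punchOut-injective (y≢f x) (y≢f x′) eq)

mid-injective : ∀ {k} {i j : Fin k} → TVtx.mid i ≡ mid j → i ≡ j
mid-injective refl = refl

leaf-injective : ∀ {k} {i a i′ b : Fin k} → TVtx.leaf i a ≡ leaf i′ b → a ≡ b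
leaf-injective refl = refl

siblings-same-row : ∀ {k} (i a b : Fin k) y → tadj (leaf i a) y ≡ tadj (leaf i b) y
siblings-same-row i a b root = refl
siblings-same-row i a b (mid _) = refl
siblings-same-row i a b (leaf _ _) = refl

leaf-neighbour : ∀ {k} {i a : Fin k} y → tadj (leaf i a) y ≡ true → y ≡ mid i
leaf-neighbour (mid i′) i≡i′ = cong mid (sym (=ᵇ⇒≡ i≡i′))

-- With at least two children, every child x_i has a sibling.
other : ∀ {n} → Fin (suc (suc n)) → Fin (suc (suc n))
other zero = suc zero
other (suc _) = zero

other-≢ : ∀ {n} (i : Fin (suc (suc n))) → other i ≢ i
other-≢ zero ()
other-≢ (suc i) ()

module Numbering (k : ℕ) where

  -- Inverse of decode: x ↦ 0, x_i ↦ 1 + i, x_{ij} ↦ 1 + k + (i k + j).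
  enc : TVtx k → Fin (tsize k)
  enc root = zero
  enc (mid i) = suc (i ↑ˡ (k * k))
  enc (leaf i j) = suc (k ↑ʳ combine i j)

  decode-leafBlock : ∀ z → decode k (suc (k ↑ʳ z)) ≡ uncurry leaf (remQuot k z)
  decode-leafBlock z rewrite splitAt-↑ʳ k (k * k) z with remQuot {k} k z
  ... | i , j = refl

  decode-enc : ∀ a → decode k (enc a) ≡ a
  decode-enc root = refl
  decode-enc (mid i) rewrite splitAt-↑ˡ k i (k * k) = refl
  decode-enc (leaf i j) =
    trans (decode-leafBlock (combine i j)) (cong (uncurry leaf) (remQuot-combine {k} {k} i j))

  enc-decode : ∀ x → enc (decode k x) ≡ x
  enc-decode zero = refl
  enc-decode (suc y) with splitAt k y in split
  ... | inj₁ i = cong suc (splitAt⁻¹-↑ˡ split)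
  ... | inj₂ z = cong suc (trans (cong (k ↑ʳ_) (combine-remQuot {k} k z)) (splitAt⁻¹-↑ʳ split))

  decode-injective : ∀ {x y} → decode k x ≡ decode k y → x ≡ y
  decode-injective {x} {y} eq = trans (sym (enc-decode x)) (trans (cong enc eq) (enc-decode y))

  enc-injective : ∀ {a b} → enc a ≡ enc b → a ≡ b
  enc-injective {a} {b} eq = trans (sym (decode-enc a)) (trans (cong (decode k) eq) (decode-enc b))

  adj-enc : ∀ a w → adj (T k) (enc a) w ≡ tadj a (decode k w)
  adj-enc a w = cong (λ a′ → tadj a′ (decode k w)) (decode-enc a)

  adj-enc₂ : ∀ a b → adj (T k) (enc a) (enc b) ≡ tadj a b
  adj-enc₂ a b = trans (adj-enc a (enc b)) (cong (tadj a) (decode-enc b))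

  siblings-adj : ∀ i a b w → adj (T k) (enc (leaf i a)) w ≡ adj (T k) (enc (leaf i b)) w
  siblings-adj i a b w =
    trans (adj-enc (leaf i a) w) (trans (siblings-same-row i a b (decode k w)) (sym (adj-enc (leaf i b) w)))

  count-levels : ∀ (P : TVtx k → Bool) →
    count (tsize k) (λ x → P (decode k x))
      ≡ count 1 (λ _ → P root)
        + (count k (λ i → P (mid i)) + count (k * k) (λ z → P (uncurry leaf (remQuot k z))))
  count-levels P = begin
      count (tsize k) (λ x → P (decode k x))
    ≡⟨ count-+ 1 (k + k * k) (λ x → P (decode k x)) ⟩
      count 1 (λ _ → P root) + count (k + k * k) (λ y → P (decode k (suc y)))
    ≡⟨ cong (count 1 (λ _ → P root) +_) (count-+ k (k * k) (λ y → P (decode k (suc y)))) ⟩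
      count 1 (λ _ → P root) + (count k (λ i → P (decode k (enc (mid i))))
                                + count (k * k) (λ z → P (decode k (suc (k ↑ʳ z)))))
    ≡⟨ cong (count 1 (λ _ → P root) +_)
            (cong₂ _+_ (count-cong k (λ i → cong P (decode-enc (mid i))))
                       (count-cong (k * k) (λ z → cong P (decode-leafBlock z)))) ⟩
      count 1 (λ _ → P root)
        + (count k (λ i → P (mid i)) + count (k * k) (λ z → P (uncurry leaf (remQuot k z)))) ∎
    where
    open ≡-Reasoning

module TwinNumberOfT (k′ : ℕ) where

  K : ℕ
  K = suc (suc k′)

  G : Graph (tsize K)
  G = T K

  open Numbering K
  open Twins G

  isLeafOf : Fin K → TVtx K → Bool
  isLeafOf i root = false
  isLeafOf i (mid _) = false
  isLeafOf i (leaf i′ _) = i′ =ᵇ i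

  not-twinT : ∀ a b y → y ≢ a → y ≢ b → tadj a y ≢ tadj b y → twinᵇ G (enc a) (enc b) ≡ false
  not-twinT a b y y≢a y≢b differ =
    not-twin (enc a) (enc b) (enc y) (y≢a ∘ enc-injective) (y≢b ∘ enc-injective)
      (λ same → differ (trans (sym (adj-enc₂ a y)) (trans same (adj-enc₂ b y))))

  siblings-twins : ∀ i a b → twinᵇ G (enc (leaf i a)) (enc (leaf i b)) ≡ true
  siblings-twins i a b = twin-intro (enc (leaf i a)) (enc (leaf i b)) (siblings-adj i a b)

  twin-leaf : ∀ i a b → twinᵇ G (enc (leaf i a)) (enc b) ≡ isLeafOf i b
  twin-leaf i a root =
    not-twinT (leaf i a) root (mid (other i)) (λ ()) (λ ()) (λ i=other → other-≢ i (sym (=ᵇ⇒≡ i=other)))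
  twin-leaf i a (mid i′) = not-twinT (leaf i a) (mid i′) root (λ ()) (λ ()) (λ ())
  twin-leaf i a (leaf i′ b) with i′ ≟ i
  ... | yes refl = siblings-twins i a b
  ... | no i′≢i = not-twinT (leaf i a) (leaf i′ b) (mid i) (λ ()) (λ ())
                    (λ same → i′≢i (=ᵇ⇒≡ (trans (sym same) (=ᵇ-refl i))))

  twin-root : ∀ b → twinᵇ G (enc root) (enc b) ≡ true → b ≡ root
  twin-root root _ = refl
  twin-root (mid i) twins with () ← trans (sym twins)
    (not-twinT root (mid i) (mid (other i)) (λ ()) (other-≢ i ∘ mid-injective) (λ ()))
  twin-root (leaf i b) twins with () ← trans (sym twins)
    (not-twinT root (leaf i b) (mid (other i)) (λ ()) (λ ())
       (λ i=other → other-≢ i (sym (=ᵇ⇒≡ (sym i=other)))))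

  twin-mid : ∀ i b → twinᵇ G (enc (mid i)) (enc b) ≡ true → b ≡ mid i
  twin-mid i root twins with () ← trans (sym twins)
    (not-twinT (mid i) root (mid (other i)) (other-≢ i ∘ mid-injective) (λ ()) (λ ()))
  twin-mid i (mid i′) twins with i′ ≟ i
  ... | yes i′≡i = cong mid i′≡i
  ... | no i′≢i with () ← trans (sym twins)
    (not-twinT (mid i) (mid i′) (leaf i zero) (λ ()) (λ ())
       (λ same → i′≢i (=ᵇ⇒≡ (trans (sym same) (=ᵇ-refl i)))))
  twin-mid i (leaf i′ b) twins with () ← trans (sym twins)
    (not-twinT (mid i) (leaf i′ b) root (λ ()) (λ ()) (λ ()))

  classSize-leaf : ∀ i a → twinClassSize G (enc (leaf i a)) ≡ K
  classSize-leaf i a = begin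
      twinClassSize G (enc (leaf i a))
    ≡⟨ twinClassSize-count (enc (leaf i a)) ⟩
      count (tsize K) (twinᵇ G (enc (leaf i a)))
    ≡⟨ count-cong (tsize K) (λ x → trans (cong (twinᵇ G (enc (leaf i a))) (sym (enc-decode x)))
                                         (twin-leaf i a (decode K x))) ⟩
      count (tsize K) (λ x → isLeafOf i (decode K x))
    ≡⟨ count-levels (isLeafOf i) ⟩
      count K (λ _ → false) + count (K * K) (λ z → isLeafOf i (uncurry leaf (remQuot K z)))
    ≡⟨ cong₂ _+_ (count-const K false)
                 (count-rows K K (λ z → isLeafOf i (uncurry leaf (remQuot K z))) (λ i′ → i′ =ᵇ i)
                    (λ i′ j → cong (isLeafOf i ∘ uncurry leaf) (remQuot-combine {K} {K} i′ j))) ⟩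
      count K (λ i′ → i′ =ᵇ i) * K
    ≡⟨ cong (_* K) (count-unique K (λ i′ → i′ =ᵇ i) i (=ᵇ-refl i) (λ i′ i′=i → =ᵇ⇒≡ i′=i)) ⟩
      1 * K
    ≡⟨ *-identityˡ K ⟩
      K ∎
    where open ≡-Reasoning

  classSize-singleton : ∀ a → (∀ b → twinᵇ G (enc a) (enc b) ≡ true → b ≡ a) → twinClassSize G (enc a) ≡ 1
  classSize-singleton a only-a =
    trans (twinClassSize-count (enc a))
          (count-unique (tsize K) (twinᵇ G (enc a)) (enc a) (twin-intro (enc a) (enc a) (λ _ → refl))
            (λ x twins → trans (sym (enc-decode x))
                               (cong enc (only-a (decode K x) (subst (λ y → twinᵇ G (enc a) y ≡ true)
                                                                     (sym (enc-decode x)) twins)))))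

  twinNumber : TwinNumber G K
  twinNumber = (enc (leaf zero zero) , classSize-leaf zero zero) , bounded
    where
    bounded-enc : ∀ a → twinClassSize G (enc a) ≤ K
    bounded-enc root = ≤-trans (≤-reflexive (classSize-singleton root twin-root)) (s≤s z≤n)
    bounded-enc (mid i) = ≤-trans (≤-reflexive (classSize-singleton (mid i) (twin-mid i))) (s≤s z≤n)
    bounded-enc (leaf i a) = ≤-reflexive (classSize-leaf i a)
    bounded : ∀ u → twinClassSize G u ≤ K
    bounded u = subst (λ x → twinClassSize G x ≤ K) (enc-decode u) (bounded-enc (decode K u))

module PartitionDimensionOfT (k′ : ℕ) where

  K : ℕ
  K = suc (suc k′)

  G : Graph (tsize K)
  G = T K

  open Numbering K

  cls : TVtx K → Fin (suc K)
  cls root = zero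
  cls (mid i) = suc i
  cls (leaf i j) = suc j

  Π : Fin (tsize K) → Fin (suc K)
  Π x = cls (decode K x)

  module Upper where

    open Representations G Π

    Π-enc : ∀ a → Π (enc a) ≡ cls a
    Π-enc a = cong cls (decode-enc a)

    near : ∀ a b → SameCode (enc a) (enc b) → ∀ y → tadj a y ≡ true →
           ∃ λ y′ → cls y′ ≡ cls y × (b ≡ y′ ⊎ tadj b y′ ≡ true)
    near a b same y ay = on-tree (sameCode-near (enc a) (enc b) same (enc y) (trans (adj-enc₂ a y) ay))
      where
      on-tree : (∃ λ w → Π w ≡ Π (enc y) × (enc b ≡ w ⊎ adj G (enc b) w ≡ true)) →
                ∃ λ y′ → cls y′ ≡ cls y × (b ≡ y′ ⊎ tadj b y′ ≡ true)
      on-tree (w , Πw , inj₁ b≡w) =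
        decode K w , trans Πw (Π-enc y) , inj₁ (trans (sym (decode-enc b)) (cong (decode K) b≡w))
      on-tree (w , Πw , inj₂ bw) =
        decode K w , trans Πw (Π-enc y) , inj₂ (trans (sym (adj-enc b w)) bw)

    leaf-sees : ∀ a i j → SameCode (enc a) (enc (leaf i j)) → ∀ y → tadj a y ≡ true →
                cls y ≡ suc j ⊎ cls y ≡ suc i
    leaf-sees a i j same y ay = from-near (near a (leaf i j) same y ay)
      where
      from-near : (∃ λ y′ → cls y′ ≡ cls y × (leaf i j ≡ y′ ⊎ tadj (leaf i j) y′ ≡ true)) →
                  cls y ≡ suc j ⊎ cls y ≡ suc i
      from-near (y′ , same-cls , inj₁ leaf≡y′) = inj₁ (trans (sym same-cls) (cong cls (sym leaf≡y′)))
      from-near (y′ , same-cls , inj₂ adjacent) =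
        inj₂ (trans (sym same-cls) (cong cls (leaf-neighbour y′ adjacent)))

    symCode : ∀ u v → SameCode u v → SameCode v u
    symCode u v same l = sym (same l)

    -- x_i (near the class of x) and a leaf (far from it) are told apart.
    root-unseen : ∀ {i j : Fin K} → Fin.zero ≡ suc j ⊎ Fin.zero ≡ suc i → ⊥
    root-unseen (inj₁ ())
    root-unseen (inj₂ ())

    -- Leaves x_{ij}, x_{i′j} of one class are told apart by the class of x_i or of x_{i′}.
    parents : ∀ i i′ j j′ → j ≡ j′ → SameCode (enc (leaf i j)) (enc (leaf i′ j′)) → i ≡ i′
    parents i i′ j j′ j≡j′ same = from-i (leaf-sees (leaf i j) i′ j′ same (mid i) (=ᵇ-refl i))
      where
      from-i′ : i ≡ j′ → suc i′ ≡ suc j ⊎ suc i′ ≡ suc i → i ≡ i′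
      from-i′ i≡j′ (inj₁ i′≡j) = trans i≡j′ (trans (sym j≡j′) (sym (suc-injective i′≡j)))
      from-i′ _ (inj₂ i′≡i) = sym (suc-injective i′≡i)
      from-i : suc i ≡ suc j′ ⊎ suc i ≡ suc i′ → i ≡ i′
      from-i (inj₁ i≡j′) = from-i′ (suc-injective i≡j′)
        (leaf-sees (leaf i′ j′) i j (symCode (enc (leaf i j)) (enc (leaf i′ j′)) same) (mid i′) (=ᵇ-refl i′))
      from-i (inj₂ i≡i′) = suc-injective i≡i′

    -- Vertices of equal representation lie in one class, which separates
    -- all pairs except those handled by root-unseen and parents.
    codes-separate : ∀ a b → SameCode (enc a) (enc b) → a ≡ b
    codes-separate a b same = by-shape a b same-cls same
      where
      same-cls : cls a ≡ cls b
      same-cls = trans (sym (Π-enc a)) (trans (sameCode⇒sameClass (enc a) (enc b) same) (Π-enc b))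

      by-shape : ∀ a b → cls a ≡ cls b → SameCode (enc a) (enc b) → a ≡ b
      by-shape root root _ _ = refl
      by-shape root (mid _) 0≡suc _ = ⊥-elim (0≢1+n 0≡suc)
      by-shape root (leaf _ _) 0≡suc _ = ⊥-elim (0≢1+n 0≡suc)
      by-shape (mid _) root suc≡0 _ = ⊥-elim (0≢1+n (sym suc≡0))
      by-shape (leaf _ _) root suc≡0 _ = ⊥-elim (0≢1+n (sym suc≡0))
      by-shape (mid i) (mid i′) i≡i′ _ = cong mid (suc-injective i≡i′)
      by-shape (mid i) (leaf i′ j) _ same′ = ⊥-elim (root-unseen (leaf-sees (mid i) i′ j same′ root refl))
      by-shape (leaf i j) (mid i′) _ same′ =
        ⊥-elim (root-unseen (leaf-sees (mid i′) i j (symCode (enc (leaf i j)) (enc (mid i′)) same′) root refl))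
      by-shape (leaf i j) (leaf i′ j′) j≡j′ same′ =
        cong₂ leaf (parents i i′ j j′ (suc-injective j≡j′) same′) (suc-injective j≡j′)

    locatingPartition : HasLocatingPartition G (suc K)
    locatingPartition = Π , onto , locating
      where
      onto : IsPartition (suc K) Π
      onto zero = enc root , Π-enc root
      onto (suc i) = enc (mid i) , Π-enc (mid i)
      locating : IsLocating G Π
      locating u v same = decode-injective (codes-separate (decode K u) (decode K v)
        (subst₂ SameCode (sym (enc-decode u)) (sym (enc-decode v)) same))

  -- In any locating partition the k leaves below one x_i are twins,
  -- hence lie in k different classes.
  module Lower {j : ℕ} (c : Fin (tsize K) → Fin j) (locating : IsLocating G c) where

    open Representations G c

    siblings-separated : ∀ i → Injective _≡_ _≡_ (λ a → c (enc (leaf i a)))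
    siblings-separated i {a} {b} same-class = leaf-injective (enc-injective {leaf i a} {leaf i b}
      (locating (enc (leaf i a)) (enc (leaf i b))
        (twins-sameCode (enc (leaf i a)) (enc (leaf i b)) (siblings-adj i a b) same-class)))

  -- With exactly k classes the leaves below x_i meet every class, so every
  -- x_i is adjacent to every class; then the x_i lie in distinct classes and
  -- meet every class as well, so the root x shares its class and its
  -- representation with some x_i.
  module ExactlyK (c : Fin (tsize K) → Fin K) (locating : IsLocating G c) where

    open Representations G c
    open Lower c locating

    mid-seesAll : ∀ i → SeesAllClasses (enc (mid i))
    mid-seesAll i l =
      let a , leaf-in-l = injective⇒surjective _ (siblings-separated i) l
      in enc (leaf i a) , leaf-in-l , trans (adj-enc₂ (mid i) (leaf i a)) (=ᵇ-refl i)

    mids-separated : Injective _≡_ _≡_ (λ i → c (enc (mid i)))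
    mids-separated {i} {i′} same-class = mid-injective (enc-injective {mid i} {mid i′}
      (locating (enc (mid i)) (enc (mid i′))
        (seesAll-sameCode (enc (mid i)) (enc (mid i′)) (mid-seesAll i) (mid-seesAll i′) same-class)))

    root-seesAll : SeesAllClasses (enc root)
    root-seesAll l =
      let i , mid-in-l = injective⇒surjective _ mids-separated l
      in enc (mid i) , mid-in-l , adj-enc₂ root (mid i)

    impossible : ⊥
    impossible =
      let i , same-class = injective⇒surjective _ mids-separated (c (enc root))
      in mid≢root (enc-injective {mid i} {root} (locating (enc (mid i)) (enc root)
           (seesAll-sameCode (enc (mid i)) (enc root) (mid-seesAll i) root-seesAll same-class)))
      where
      mid≢root : ∀ {i} → TVtx.mid i ≢ root
      mid≢root ()

  -- Fewer than k classes cannot separate the leaves below x_1; exactly k is ruled out above.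
  no-small-partition : ∀ {j} (c : Fin (tsize K) → Fin j) → IsLocating G c → j < K ⊎ j ≡ K → ⊥
  no-small-partition c locating (inj₁ j<K) =
    <⇒notInjective j<K (Lower.siblings-separated c locating zero)
  no-small-partition c locating (inj₂ refl) = ExactlyK.impossible c locating

  minimality : ∀ j → HasLocatingPartition G j → suc K ≤ j
  minimality j (c , _ , locating) = ≰⇒> (λ j≤K → no-small-partition c locating (m≤n⇒m<n∨m≡n j≤K))

mainTheorem3 : (k : ℕ) → 2 ≤ k → TwinNumber (T k) k × PartitionDimension (T k) (suc k)
mainTheorem3 (suc zero) (s≤s ())
mainTheorem3 (suc (suc k′)) _ =
  TwinNumberOfT.twinNumber k′ ,
  PartitionDimensionOfT.Upper.locatingPartition k′ ,
  PartitionDimensionOfT.minimality k′
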